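{- Let $\langle R,X\rangle$ be a trifunctional strict partial order on a nonempty finite set $X$ of $\mathbf{S}$-variables (i.e. a member of FTP) which is connected, and suppose $X$ has at least two elements. Then there are relations $\langle R_1,X_1\rangle$ and $\langle R_2,X_2\rangle$ with $X_1,X_2$ nonempty and disjoint such that $\langle R,X\rangle=\langle R_1,X_1\rangle\cdot\langle R_2,X_2\rangle$.
   Context: A relation is a pair $\langle R,X\rangle$ with $R\subseteq X^2$. For $X\cap Y=\emptyset$, $\langle R,X\rangle\cdot\langle S,Y\rangle=\langle R\cup S\cup(X\times Y),X\cup Y\rangle$. Strict partial order: irreflexive and transitive. $\langle R,X\rangle$ is trifunctional if for all $x,y,z,u\in X$: if $(x,z),(y,z),(y,u)\in R$ then $(x,u)\in R$ or $(y,x)\in R$ or $(u,z)\in R$. $\langle R,X\rangle$ is connected if for every two distinct $x,y\in X$ there is a sequence $x=x_1,\dots,x_k=y$ in $X$ with $(x_i,x_{i+1})\in R$ or $(x_{i+1},x_i)\in R$ for each $i<k$. $\mathbf{S}$-variables are elements of a fixed infinite set of variables. -}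

module Defs where

open import Data.Nat using (ℕ)
open import Data.Product using (_×_; _,_; ∃; ∃-syntax)
open import Data.Sum using (_⊎_)
open import Data.List using (List)
open import Data.List.Membership.Propositional using (_∈_)
open import Relation.Binary.PropositionalEquality using (_≡_; _≢_)
open import Relation.Nullary using (¬_)
open import Data.Empty using (⊥)
open import Function.Bundles using (_⇔_)

-- S-variables: a fixed infinite set of variables, taken to be ℕ.
Var : Set
Var = ℕ

-- A finite set of variables is represented by a list (read as a set, via ∈);
-- a relation on it is a finite set of pairs, also a list read via ∈.
FinSet : Set
FinSet = List Var

FinRel : Set
FinRel = List (Var × Var)

IsRelation : FinRel → FinSet → Set
IsRelation R X = ∀ {x y} → (x , y) ∈ R → x ∈ X × y ∈ X

Nonempty : FinSet → Set
Nonempty X = ∃[ x ] x ∈ X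

Disjoint : FinSet → FinSet → Set
Disjoint X Y = ∀ {x} → x ∈ X → x ∈ Y → ⊥

Irreflexive : FinRel → FinSet → Set
Irreflexive R X = ∀ x → x ∈ X → ¬ ((x , x) ∈ R)

Transitive : FinRel → FinSet → Set
Transitive R X = ∀ x y z → x ∈ X → y ∈ X → z ∈ X →
  (x , y) ∈ R → (y , z) ∈ R → (x , z) ∈ R

StrictPartialOrder : FinRel → FinSet → Set
StrictPartialOrder R X = Irreflexive R X × Transitive R X

Trifunctional : FinRel → FinSet → Set
Trifunctional R X = ∀ x y z u → x ∈ X → y ∈ X → z ∈ X → u ∈ X →
  (x , z) ∈ R → (y , z) ∈ R → (y , u) ∈ R →
  ((x , u) ∈ R ⊎ (y , x) ∈ R ⊎ (u , z) ∈ R)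

data Chain (R : FinRel) (X : FinSet) : Var → Var → Set where
  [_]  : ∀ {x} → x ∈ X → Chain R X x x
  _∷_ : ∀ {x z y} → x ∈ X → ((x , z) ∈ R ⊎ (z , x) ∈ R) →
         Chain R X z y → Chain R X x y

Connected : FinRel → FinSet → Set
Connected R X = ∀ x y → x ∈ X → y ∈ X → x ≢ y → Chain R X x y

AtLeastTwo : FinSet → Set
AtLeastTwo X = ∃[ x ] ∃[ y ] (x ∈ X × y ∈ X × x ≢ y)

-- ⟨R , X⟩ = ⟨R₁ , X₁⟩ · ⟨R₂ , X₂⟩  (equality of sets, read extensionally)
IsProduct : FinRel → FinSet → FinRel → FinSet → FinRel → FinSet → Set
IsProduct R X R₁ X₁ R₂ X₂ =
  (∀ x → x ∈ X ⇔ (x ∈ X₁ ⊎ x ∈ X₂)) ×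
  (∀ x y → (x , y) ∈ R ⇔ ((x , y) ∈ R₁ ⊎ (x , y) ∈ R₂ ⊎ (x ∈ X₁ × y ∈ X₂)))

module Submission where

-- Call an element *upper* if it lies above every minimal element
-- of X.  The upper elements form the piece X₂ and the remaining ones X₁.
--   (1) Every element lies above-or-equal some minimal element; in a
--       finite strict order one linear pass over X finds it.
--   (2) Connectedness plus trifunctionality propagate, along a chain,
--       the fact "c is below-or-equal something above the minimal m";
--       as X is connected this reaches every element, which lets us
--       build an element above all minimal elements, so X₂ ≠ ∅.
--   (3) If l is not upper and u is upper then l < u (trifunctionality
--       again), and upper elements are closed upwards.
-- A general splitting lemma turns (3) into the product decomposition:
-- any relation cut by a decidable up-set, with everything below the cut
-- related to everything above it, is the product of its two parts.

open import Defs
open import Data.Product using (_×_; ∃-syntax; _,_; proj₁; proj₂)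
open import Data.Product.Properties using (≡-dec)
open import Data.Sum using (_⊎_; inj₁; inj₂)
open import Data.Nat using (_≟_)
open import Data.List using (List; []; _∷_; filter)
open import Data.List.Relation.Unary.Any using (here; there)
open import Data.List.Relation.Unary.All as All using (All; []; _∷_; all?)
open import Data.List.Relation.Unary.All.Properties using (¬All⇒Any¬)
open import Data.List.Membership.Propositional using (_∈_; find)
open import Data.List.Membership.Propositional.Properties using (∈-filter⁺; ∈-filter⁻)
import Data.List.Membership.DecPropositional as DecMembership
open import Relation.Binary.PropositionalEquality using (_≡_; _≢_; refl; sym)
open import Relation.Nullary using (¬_; Dec; yes; no; ¬?; _×-dec_; _→-dec_)
open import Relation.Nullary.Decidable using (map′)
open import Data.Empty using (⊥-elim)
open import Function.Bundles using (_⇔_; mk⇔)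

-- Scanning a list once and
-- moving the candidate down whenever a smaller element appears ends at
-- an element below the start that no element of the list lies under:
-- a later candidate is below every earlier one, so transitivity and
-- irreflexivity forbid anything already passed from lying below it.
module MinimalElements {A : Set} (_<_ : A → A → Set)
  (_<?_ : ∀ a b → Dec (a < b))
  (irrefl : ∀ {a} → ¬ (a < a))
  (trans : ∀ {a b c} → a < b → b < c → a < c) where

  _≼_ : A → A → Set
  a ≼ b = a ≡ b ⊎ a < b

  ≼-<-trans : ∀ {a b c} → a ≼ b → b < c → a < c
  ≼-<-trans (inj₁ refl) b<c = b<c
  ≼-<-trans (inj₂ a<b) b<c = trans a<b b<c

  <-≼-trans : ∀ {a b c} → a < b → b ≼ c → a < c
  <-≼-trans a<b (inj₁ refl) = a<b
  <-≼-trans a<b (inj₂ b<c) = trans a<b b<c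

  descend : (c : A) (L : List A) → ∃[ r ] (r ≼ c × All (λ z → ¬ (z < r)) L)
  descend c [] = c , inj₁ refl , []
  descend c (y ∷ ys) with y <? c
  ... | yes y<c =
    let (r , r≼y , rMin) = descend y ys
    in r , inj₂ (≼-<-trans r≼y y<c) , (λ y<r → irrefl (<-≼-trans y<r r≼y)) ∷ rMin
  ... | no y≮c =
    let (r , r≼c , rMin) = descend c ys
    in r , r≼c , (λ y<r → y≮c (<-≼-trans y<r r≼c)) ∷ rMin

module Split (R : FinRel) (X : FinSet) (isRel : IsRelation R X)
  {U : Var → Set} (U? : ∀ x → Dec (U x)) where

  outside? : ∀ x → Dec (¬ U x)
  outside? x = ¬? (U? x)

  bothOutside? : ∀ (p : Var × Var) → Dec (¬ U (proj₁ p) × ¬ U (proj₂ p))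
  bothOutside? (x , y) = outside? x ×-dec outside? y

  bothInside? : ∀ (p : Var × Var) → Dec (U (proj₁ p) × U (proj₂ p))
  bothInside? (x , y) = U? x ×-dec U? y

  X₁ X₂ : FinSet
  X₁ = filter outside? X
  X₂ = filter U? X

  R₁ R₂ : FinRel
  R₁ = filter bothOutside? R
  R₂ = filter bothInside? R

  isRelation₁ : IsRelation R₁ X₁
  isRelation₁ p with ∈-filter⁻ bothOutside? {xs = R} p
  ... | q , (¬Ux , ¬Uy) = ∈-filter⁺ outside? (proj₁ (isRel q)) ¬Ux ,
                          ∈-filter⁺ outside? (proj₂ (isRel q)) ¬Uy

  isRelation₂ : IsRelation R₂ X₂
  isRelation₂ p with ∈-filter⁻ bothInside? {xs = R} p
  ... | q , (Ux , Uy) = ∈-filter⁺ U? (proj₁ (isRel q)) Ux ,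
                        ∈-filter⁺ U? (proj₂ (isRel q)) Uy

  disjoint : Disjoint X₁ X₂
  disjoint p q = proj₂ (∈-filter⁻ outside? {xs = X} p) (proj₂ (∈-filter⁻ U? {xs = X} q))

  carrierSplits : ∀ x → x ∈ X ⇔ (x ∈ X₁ ⊎ x ∈ X₂)
  carrierSplits x = mk⇔ to from
    where
    to : x ∈ X → x ∈ X₁ ⊎ x ∈ X₂
    to x∈X with U? x
    ... | yes Ux = inj₂ (∈-filter⁺ U? x∈X Ux)
    ... | no ¬Ux = inj₁ (∈-filter⁺ outside? x∈X ¬Ux)
    from : x ∈ X₁ ⊎ x ∈ X₂ → x ∈ X
    from (inj₁ p) = proj₁ (∈-filter⁻ outside? {xs = X} p)
    from (inj₂ p) = proj₁ (∈-filter⁻ U? {xs = X} p)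

  relationSplits : (∀ {x y} → (x , y) ∈ R → U x → U y) →
    (∀ {x y} → x ∈ X → y ∈ X → ¬ U x → U y → (x , y) ∈ R) →
    ∀ x y → (x , y) ∈ R ⇔ ((x , y) ∈ R₁ ⊎ (x , y) ∈ R₂ ⊎ (x ∈ X₁ × y ∈ X₂))
  relationSplits upClosed cross x y = mk⇔ to from
    where
    to : (x , y) ∈ R → (x , y) ∈ R₁ ⊎ (x , y) ∈ R₂ ⊎ (x ∈ X₁ × y ∈ X₂)
    to p with U? x | U? y
    ... | no ¬Ux | no ¬Uy = inj₁ (∈-filter⁺ bothOutside? p (¬Ux , ¬Uy))
    ... | yes Ux | yes Uy = inj₂ (inj₁ (∈-filter⁺ bothInside? p (Ux , Uy)))
    ... | no ¬Ux | yes Uy = inj₂ (inj₂ (∈-filter⁺ outside? (proj₁ (isRel p)) ¬Ux ,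
                                        ∈-filter⁺ U? (proj₂ (isRel p)) Uy))
    ... | yes Ux | no ¬Uy = ⊥-elim (¬Uy (upClosed p Ux))
    from : (x , y) ∈ R₁ ⊎ (x , y) ∈ R₂ ⊎ (x ∈ X₁ × y ∈ X₂) → (x , y) ∈ R
    from (inj₁ p) = proj₁ (∈-filter⁻ bothOutside? {xs = R} p)
    from (inj₂ (inj₁ p)) = proj₁ (∈-filter⁻ bothInside? {xs = R} p)
    from (inj₂ (inj₂ (p , q))) with ∈-filter⁻ outside? {xs = X} p | ∈-filter⁻ U? {xs = X} q
    ... | x∈X , ¬Ux | y∈X , Uy = cross x∈X y∈X ¬Ux Uy

splitProduct : (R : FinRel) (X : FinSet) → IsRelation R X →
  {U : Var → Set} → (∀ x → Dec (U x)) →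
  (∀ {x y} → (x , y) ∈ R → U x → U y) →
  (∀ {x y} → x ∈ X → y ∈ X → ¬ U x → U y → (x , y) ∈ R) →
  ∃[ a ] (a ∈ X × ¬ U a) → ∃[ b ] (b ∈ X × U b) →
  ∃[ R₁ ] ∃[ X₁ ] ∃[ R₂ ] ∃[ X₂ ]
    (IsRelation R₁ X₁ × IsRelation R₂ X₂ ×
     Nonempty X₁ × Nonempty X₂ × Disjoint X₁ X₂ ×
     IsProduct R X R₁ X₁ R₂ X₂)
splitProduct R X isRel U? upClosed cross (a , a∈X , ¬Ua) (b , b∈X , Ub) =
  R₁ , X₁ , R₂ , X₂ , isRelation₁ , isRelation₂ ,
  (a , ∈-filter⁺ outside? a∈X ¬Ua) , (b , ∈-filter⁺ U? b∈X Ub) ,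
  disjoint , carrierSplits , relationSplits upClosed cross
  where open Split R X isRel U?

_∈R?_ : (p : Var × Var) (R : FinRel) → Dec (p ∈ R)
_∈R?_ = DecMembership._∈?_ (≡-dec _≟_ _≟_)

module TrifunctionalOrder (R : FinRel) (X : FinSet) (isRel : IsRelation R X)
  (spo : StrictPartialOrder R X) (tri : Trifunctional R X)
  (con : Connected R X) (two : AtLeastTwo X) where

  -- since R ⊆ X², the order axioms hold without membership side conditions
  _<_ : Var → Var → Set
  a < b = (a , b) ∈ R

  _<?_ : ∀ a b → Dec (a < b)
  a <? b = (a , b) ∈R? R

  irrefl : ∀ {a} → ¬ (a < a)
  irrefl a<a = proj₁ spo _ (proj₁ (isRel a<a)) a<a

  trans : ∀ {a b c} → a < b → b < c → a < c
  trans a<b b<c =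
    proj₂ spo _ _ _ (proj₁ (isRel a<b)) (proj₂ (isRel a<b)) (proj₂ (isRel b<c)) a<b b<c

  trifunctional : ∀ {x y z u} → x < z → y < z → y < u → x < u ⊎ y < x ⊎ u < z
  trifunctional x<z y<z y<u =
    tri _ _ _ _ (proj₁ (isRel x<z)) (proj₁ (isRel y<z)) (proj₂ (isRel x<z))
      (proj₂ (isRel y<u)) x<z y<z y<u

  open MinimalElements _<_ _<?_ irrefl trans

  Minimal : Var → Set
  Minimal m = ∀ y → ¬ (y < m)

  -- only elements of X can lie below anything, so it suffices to test X
  minimalFromX : ∀ {m} → All (λ y → ¬ (y < m)) X → Minimal m
  minimalFromX noneBelow y y<m = All.lookup noneBelow (proj₁ (isRel y<m)) y<m

  minimal? : ∀ m → Dec (Minimal m)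
  minimal? m = map′ minimalFromX (λ min → All.tabulate (λ {y} _ → min y))
                    (all? (λ y → ¬? (y <? m)) X)

  ≼-∈ : ∀ {a b} → b ∈ X → a ≼ b → a ∈ X
  ≼-∈ b∈X (inj₁ refl) = b∈X
  ≼-∈ b∈X (inj₂ a<b) = proj₁ (isRel a<b)

  minimalBelow : ∀ {x} → x ∈ X → ∃[ m ] (m ∈ X × Minimal m × m ≼ x)
  minimalBelow {x} x∈X with descend x X
  ... | m , m≼x , noneBelow = m , ≼-∈ x∈X m≼x , minimalFromX noneBelow , m≼x

  partner : ∀ m → ∃[ t ] (t ∈ X × m ≢ t)
  partner m = partnerFrom two
    where
    partnerFrom : AtLeastTwo X → ∃[ t ] (t ∈ X × m ≢ t)
    partnerFrom (x , y , x∈X , y∈X , x≢y) with m ≟ x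
    ... | yes refl = y , y∈X , x≢y
    ... | no m≢x = x , x∈X , m≢x

  firstStepUp : ∀ {m t} → Minimal m → m ≢ t → Chain R X m t → ∃[ w ] (m < w)
  firstStepUp min m≢t [ _ ] = ⊥-elim (m≢t refl)
  firstStepUp min m≢t (_∷_ {z = z} _ (inj₁ m<z) _) = z , m<z
  firstStepUp min m≢t (_∷_ {z = z} _ (inj₂ z<m) _) = ⊥-elim (min z z<m)

  aboveMinimal : ∀ {m} → m ∈ X → Minimal m → ∃[ w ] (m < w)
  aboveMinimal {m} m∈X min with partner m
  ... | t , t∈X , m≢t = firstStepUp min m≢t (con m t m∈X t∈X m≢t)

  Dominated : Var → Var → Set
  Dominated m c = ∃[ w ] (m < w × c ≼ w)

  dominatedStep : ∀ {m c d} → Minimal m → Dominated m c → c < d ⊎ d < c → Dominated m d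
  dominatedStep min (w , m<w , c≼w) (inj₂ d<c) = w , m<w , inj₂ (<-≼-trans d<c c≼w)
  dominatedStep min (w , m<w , inj₁ refl) (inj₁ c<d) = _ , trans m<w c<d , inj₁ refl
  dominatedStep {c = c} min (w , m<w , inj₂ c<w) (inj₁ c<d) with trifunctional m<w c<w c<d
  ... | inj₁ m<d = _ , m<d , inj₁ refl
  ... | inj₂ (inj₁ c<m) = ⊥-elim (min c c<m)
  ... | inj₂ (inj₂ d<w) = w , m<w , inj₂ d<w

  dominatedAlong : ∀ {m a c} → Minimal m → Chain R X a c → Dominated m a → Dominated m c
  dominatedAlong min [ _ ] dom = dom
  dominatedAlong min (_∷_ _ step rest) dom =
    dominatedAlong min rest (dominatedStep min dom step)

  dominated : ∀ {m c} → m ∈ X → Minimal m → c ∈ X → Dominated m c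
  dominated {m} {c} m∈X min c∈X with aboveMinimal m∈X min | c ≟ m
  ... | w , m<w | yes refl = w , m<w , inj₂ m<w
  ... | w , m<w | no c≢m =
    dominatedAlong min (con m c m∈X c∈X (λ m≡c → c≢m (sym m≡c))) (w , m<w , inj₂ m<w)

  Upper : Var → Set
  Upper y = All (λ m → Minimal m → m < y) X

  upper? : ∀ y → Dec (Upper y)
  upper? y = all? (λ m → minimal? m →-dec (m <? y)) X

  upperClosed : ∀ {x y} → x < y → Upper x → Upper y
  upperClosed x<y = All.map (λ below min → trans (below min) x<y)

  upperBound : ∀ (L : List Var) → (∀ {a} → a ∈ L → a ∈ X) → Nonempty X →
    ∃[ w ] (w ∈ X × All (λ m → Minimal m → m < w) L)
  upperBound [] _ (x , x∈X) = x , x∈X , []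
  upperBound (a ∷ L) L⊆X ne with upperBound L (λ p → L⊆X (there p)) ne | minimal? a
  ... | w , w∈X , below | no ¬min = w , w∈X , (λ min → ⊥-elim (¬min min)) ∷ below
  ... | w , w∈X , below | yes min with dominated (L⊆X (here refl)) min w∈X
  ...   | w' , a<w' , w≼w' =
    w' , proj₂ (isRel a<w') ,
    (λ _ → a<w') ∷ All.map (λ b<w min′ → <-≼-trans (b<w min′) w≼w') below

  missedMinimal : ∀ {l} → ¬ Upper l → ∃[ m ] (m ∈ X × Minimal m × ¬ (m < l))
  missedMinimal {l} ¬Ul with find (¬All⇒Any¬ (λ m → minimal? m →-dec (m <? l)) X ¬Ul)
  ... | m , m∈X , m≮l with minimal? m
  ...   | yes min = m , m∈X , min , (λ m<l → m≮l (λ _ → m<l))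
  ...   | no ¬min = ⊥-elim (m≮l (λ min → ⊥-elim (¬min min)))

  -- With m minimal, m ≮ l, and m' minimal, m' < l: both m, m' < u, so
  -- trifunctionality gives m < l, m' < m or l < u, the first two absurd.
  belowUpper : ∀ {l u} → l ∈ X → ¬ Upper l → Upper u → l < u
  belowUpper l∈X ¬Ul Uu with missedMinimal ¬Ul | minimalBelow l∈X
  ... | _ | m' , m'∈X , min' , inj₁ refl = All.lookup Uu m'∈X min'
  ... | m , m∈X , min , m≮l | m' , m'∈X , min' , inj₂ m'<l
    with trifunctional (All.lookup Uu m∈X min) (All.lookup Uu m'∈X min') m'<l
  ...   | inj₁ m<l = ⊥-elim (m≮l m<l)
  ...   | inj₂ (inj₁ m'<m) = ⊥-elim (min m' m'<m)
  ...   | inj₂ (inj₂ l<u) = l<u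

proposition3p2 : (R : FinRel) (X : FinSet) →
    IsRelation R X → Nonempty X → StrictPartialOrder R X →
    Trifunctional R X → Connected R X → AtLeastTwo X →
    ∃[ R₁ ] ∃[ X₁ ] ∃[ R₂ ] ∃[ X₂ ]
    (IsRelation R₁ X₁ × IsRelation R₂ X₂ ×
    Nonempty X₁ × Nonempty X₂ × Disjoint X₁ X₂ ×
    IsProduct R X R₁ X₁ R₂ X₂)
proposition3p2 R X isRel ne spo tri con two =
  splitProduct R X isRel upper? upperClosed (λ x∈X _ → belowUpper x∈X)
    lowerWitness upperWitness
  where
  open TrifunctionalOrder R X isRel spo tri con two
  lowerWitness : ∃[ a ] (a ∈ X × ¬ Upper a)
  lowerWitness with minimalBelow (proj₂ ne)
  ... | m , m∈X , min , _ = m , m∈X , (λ Um → irrefl (All.lookup Um m∈X min))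
  upperWitness : ∃[ b ] (b ∈ X × Upper b)
  upperWitness = upperBound X (λ p → p) ne
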